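{- Let $n,m\ge1$ and let $C_k$ denote the $k$-th Catalan number. If $k$ is an integer with $C_{n-1}<k<C_n$, then $k\notin R(n,m)$. Equivalently, every word $P$ of length $2n$ over a complementary alphabet with $m$ pairs having at least one but fewer than $C_n$ $P$-valid plane trees has at most $C_{n-1}$ $P$-valid plane trees.
   Context: A complementary alphabet with $m$ complementary pairs is a set of $2m$ letters in which every letter $B$ has a unique complement $\overline{B}\neq B$ with $\overline{\overline{B}}=B$. A plane tree is a rooted tree with linearly ordered children at each vertex. For a plane tree with $n$ edges, the $2n$ half-edges are labeled $1,\dots,2n$ by starting on the left side of the leftmost root edge and walking counterclockwise; each edge is $e(i,j)$, $i<j$, with $i,j$ the labels of its sides. For $P=p_1\cdots p_{2n}$, a plane tree with $n$ edges is $P$-valid if $p_i,p_j$ are complements for every edge $e(i,j)$; $V(P)$ is the set of $P$-valid plane trees. $R(n,m)$ is the set of integers $k$ such that some word $P$ of length $2n$ over a complementary alphabet with $m$ pairs has $|V(P)|=k\ge1$. -}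

module Defs where

open import Data.Nat using (ℕ; zero; suc; _+_; _*_; _∸_; _/_)
open import Data.Nat.Combinatorics using (_C_)
open import Data.Fin using (Fin; toℕ)
open import Data.List using (List; []; _∷_; _++_)
open import Data.List.Relation.Unary.All using (All)
open import Data.Product using (Σ; _×_; _,_; ∃₂)
open import Data.Vec using (Vec; lookup)
open import Function.Bundles using (_↔_)
open import Relation.Binary.PropositionalEquality using (_≡_; _≢_)

catalan : ℕ → ℕ
catalan n = ((2 * n) C n) / suc n

-- Complementary alphabets with m pairs.
-- The 2m letters are represented by Fin (2 * m); a complementation is a
-- fixed-point-free involution on the letters.

record Complementation (m : ℕ) : Set where
  field
    comp       : Fin (2 * m) → Fin (2 * m)
    involutive : ∀ b → comp (comp b) ≡ b
    noFixed    : ∀ b → comp b ≢ b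
open Complementation public

data PlaneTree : Set where
  node : List PlaneTree → PlaneTree

edgesT : PlaneTree → ℕ
edgesF : List PlaneTree → ℕ
edgesT (node ts) = edgesF ts
edgesF [] = 0
edgesF (t ∷ ts) = suc (edgesT t + edgesF ts)

-- Half-edge labelling: walk around the tree counterclockwise starting on
-- the left side of the leftmost root edge, labelling the sides 1,2,...
-- Each edge is returned as a pair (i , j), i < j, of the labels of its
-- two sides.  'edgePairsF s ts' labels the forest ts hanging below a
-- vertex, with the first label used being s.
edgePairsT : ℕ → PlaneTree → List (ℕ × ℕ)
edgePairsF : ℕ → List PlaneTree → List (ℕ × ℕ)
edgePairsT s (node ts) = edgePairsF s ts
edgePairsF s [] = []
edgePairsF s (t ∷ ts) =
  (s , s + 2 * edgesT t + 1) ∷ (edgePairsT (suc s) t ++ edgePairsF (s + 2 * edgesT t + 2) ts)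

edgePairs : PlaneTree → List (ℕ × ℕ)
edgePairs = edgePairsT 1

-- P-validity.  A word P = p_1 ... p_{2n} is a Vec of letters; p_i is
-- 'lookup P f' with toℕ f = i - 1.

Complements : ∀ {m} → Complementation m → Fin (2 * m) → Fin (2 * m) → Set
Complements c a b = comp c a ≡ b

LettersComplementary : ∀ {m n} → Complementation m → Vec (Fin (2 * m)) (2 * n)
                     → ℕ × ℕ → Set
LettersComplementary {m} {n} c P (i , j) =
  ∃₂ λ (fi fj : Fin (2 * n)) →
    suc (toℕ fi) ≡ i × suc (toℕ fj) ≡ j × Complements c (lookup P fi) (lookup P fj)

Valid : ∀ {m} n → Complementation m → Vec (Fin (2 * m)) (2 * n) → PlaneTree → Set
Valid {m} n c P t = All (LettersComplementary {m} {n} c P) (edgePairs t)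

V : ∀ {m} n → Complementation m → Vec (Fin (2 * m)) (2 * n) → Set
V {m} n c P = Σ PlaneTree λ t → edgesT t ≡ n × Valid n c P t

HasSize : Set → ℕ → Set
HasSize X k = Fin k ↔ X

InR : ℕ → ℕ → ℕ → Set
InR n m k = Σ (Complementation m) λ c → Σ (Vec (Fin (2 * m)) (2 * n)) λ P →
  HasSize (V n c P) k × 1 Data.Nat.≤ k

module Submission where

-- Every edge e(i, j) of a plane tree has j − i odd.  Twisting the letter at position p
-- by the complementation p times turns "p_i and p_j are complementary" into "the twisted letters at
-- i and j agree", so colouring each position by whether its twisted letter agrees with the one at
-- position 1 makes every edge of a P-valid tree monochromatic.  If all 2n positions get the same
-- colour, every plane tree is P-valid and |V(P)| = C_n.  Otherwise let t, f ≥ 1 be the sizes of the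
-- two colour classes.  Peeling off the root edge of the first tree and using Segner's recurrence
-- bounds |V(P)| by M(t) M(f), where M(2a) = C_a and M vanishes at odd arguments; as t + f = 2n,
-- the super-multiplicativity C_{a+1} C_{b+1} ≤ C_{a+b+1} bounds this by C_{n−1}.

open import Defs
open import Data.Nat using (ℕ; _≤_; _<_; _∸_)
open import Relation.Nullary using (¬_)

open import Axiom.UniquenessOfIdentityProofs using (module Decidable⇒UIP)
open import Data.Bool using (Bool; true; false; not; if_then_else_)
open import Data.Bool.Properties using () renaming (_≟_ to _≟ᵇ_)
open import Data.Empty using (⊥-elim)
open import Data.Fin using (Fin; toℕ; fromℕ<)
open import Data.Fin.Properties using (injective⇒≤; any?; toℕ-injective; toℕ<n; toℕ-fromℕ<; fromℕ<-toℕ)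
import Data.Fin.Properties as Fin
open import Data.List using (List; []; _∷_; _++_; length; cartesianProductWith)
import Data.List as List
open import Data.List.Membership.Propositional using (_∈_)
open import Data.List.Membership.Propositional.Properties
  using (∈-++⁺ˡ; ∈-++⁺ʳ; ∈-++⁻; ∈-cartesianProductWith⁺; ∈-cartesianProductWith⁻; ∈-lookup)
open import Data.List.Membership.Setoid.Properties using (index-injective)
open import Data.List.Properties using (length-++; length-map; ∷-injectiveˡ; ∷-injectiveʳ)
open import Data.List.Relation.Unary.All using (All; []; _∷_)
import Data.List.Relation.Unary.All as All
import Data.List.Relation.Unary.All.Properties as All
open import Data.List.Relation.Unary.AllPairs using ([]; _∷_)
open import Data.List.Relation.Unary.Any using (here; index)
open import Data.List.Relation.Unary.Unique.Propositional using (Unique)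
import Data.List.Relation.Unary.Unique.Propositional.Properties as Unique
open import Data.Maybe using (Maybe; just; nothing)
import Data.Maybe as Maybe
open import Data.Maybe.Properties using (just-injective; ≡-dec)
open import Data.Nat using (zero; suc; _+_; _*_; _/_; z≤n; s≤s; s≤s⁻¹)
open import Data.Nat.Combinatorics
  using (_C_; nCk+nC[k+1]≡[n+1]C[k+1]; nCk≡nC[n∸k]; nCn≡1; nC1≡n; k>n⇒nCk≡0)
open import Data.Nat.DivMod using (m*n/n≡m)
open import Data.Nat.Induction using (<-rec)
open import Data.Nat.Properties
open import Algebra.Properties.CommutativeSemigroup +-commutativeSemigroup
  using () renaming (interchange to +-interchange)
open import Data.Nat.Tactic.RingSolver using (solve-∀)
open import Data.Product using (Σ; ∃₂; _×_; _,_; proj₁; proj₂)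
open import Data.Sum using (_⊎_; inj₁; inj₂; [_,_]′)
import Data.Sum as Sum
open import Data.Vec using (Vec; lookup)
open import Function using (_∘_)
open import Function.Bundles using (Inverse)
open import Relation.Binary.PropositionalEquality
open import Relation.Nullary using (Dec; yes; no; does; Irrelevant; _×-dec_)
open import Relation.Nullary.Decidable using (dec-true)

∑-antidiagonal : (ℕ → ℕ → ℕ) → ℕ → ℕ
∑-antidiagonal F zero    = F 0 0
∑-antidiagonal F (suc n) = F 0 (suc n) + ∑-antidiagonal (λ i → F (suc i)) n

∑-antidiagonal-mono-≤ : ∀ {F G} n → (∀ i j → i + j ≡ n → F i j ≤ G i j) →
                        ∑-antidiagonal F n ≤ ∑-antidiagonal G n
∑-antidiagonal-mono-≤ zero    F≤G = F≤G 0 0 refl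
∑-antidiagonal-mono-≤ (suc n) F≤G =
  +-mono-≤ (F≤G 0 (suc n) refl) (∑-antidiagonal-mono-≤ n λ i j eq → F≤G (suc i) j (cong suc eq))

∑-antidiagonal-cong : ∀ {F G} n → (∀ i j → i + j ≡ n → F i j ≡ G i j) →
                      ∑-antidiagonal F n ≡ ∑-antidiagonal G n
∑-antidiagonal-cong zero    F≡G = F≡G 0 0 refl
∑-antidiagonal-cong (suc n) F≡G =
  cong₂ _+_ (F≡G 0 (suc n) refl) (∑-antidiagonal-cong n λ i j eq → F≡G (suc i) j (cong suc eq))

∑-antidiagonal-distrib-+ : ∀ F G n →
  ∑-antidiagonal (λ i j → F i j + G i j) n ≡ ∑-antidiagonal F n + ∑-antidiagonal G n
∑-antidiagonal-distrib-+ F G zero    = refl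
∑-antidiagonal-distrib-+ F G (suc n) = begin
  (F 0 (suc n) + G 0 (suc n)) + ∑-antidiagonal (λ i j → F (suc i) j + G (suc i) j) n
    ≡⟨ cong (F 0 (suc n) + G 0 (suc n) +_) (∑-antidiagonal-distrib-+ (F ∘ suc) (G ∘ suc) n) ⟩
  (F 0 (suc n) + G 0 (suc n)) + (∑-antidiagonal (F ∘ suc) n + ∑-antidiagonal (G ∘ suc) n)
    ≡⟨ +-interchange (F 0 (suc n)) (G 0 (suc n)) _ _ ⟩
  (F 0 (suc n) + ∑-antidiagonal (F ∘ suc) n) + (G 0 (suc n) + ∑-antidiagonal (G ∘ suc) n) ∎
  where open ≡-Reasoning

∑-antidiagonal-*ˡ : ∀ c F n → c * ∑-antidiagonal F n ≡ ∑-antidiagonal (λ i j → c * F i j) n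
∑-antidiagonal-*ˡ c F zero    = refl
∑-antidiagonal-*ˡ c F (suc n) =
  trans (*-distribˡ-+ c (F 0 (suc n)) _) (cong (c * F 0 (suc n) +_) (∑-antidiagonal-*ˡ c (F ∘ suc) n))

∑-antidiagonal-last : ∀ F n → F n 0 ≤ ∑-antidiagonal F n
∑-antidiagonal-last F zero    = ≤-refl
∑-antidiagonal-last F (suc n) = ≤-trans (∑-antidiagonal-last (F ∘ suc) n) (m≤n+m _ _)

infixl 7 _⋆_

_⋆_ : (ℕ → ℕ) → (ℕ → ℕ) → ℕ → ℕ
f ⋆ g = ∑-antidiagonal (λ i j → f i * g j)

-- ballot h is the (h+1)-fold convolution power of the Catalan sequence (ballot-⋆);
-- its Pascal-type recursion gives the binomial closed form (ballot+C≡C).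
ballot : ℕ → ℕ → ℕ
ballot zero    zero    = 1
ballot zero    (suc n) = ballot 1 n
ballot (suc h) zero    = 1
ballot (suc h) (suc n) = ballot h (suc n) + ballot (suc (suc h)) n

ballot-zero : ∀ h → ballot h 0 ≡ 1
ballot-zero zero    = refl
ballot-zero (suc h) = refl

ballot-⋆ : ∀ n a b → (ballot a ⋆ ballot b) n ≡ ballot (suc (a + b)) n
ballot-⋆ zero    zero    b = trans (+-identityʳ (ballot b 0)) (ballot-zero b)
ballot-⋆ (suc n) zero    b = cong₂ _+_ (+-identityʳ (ballot b (suc n))) (ballot-⋆ n 1 b)
ballot-⋆ n       (suc a) b = begin
  (ballot (suc a) ⋆ ballot b) n
    ≡⟨ ∑-antidiagonal-cong n (λ i j _ →
         trans (cong (_* ballot b j) (peel i)) (*-distribʳ-+ (ballot b j) (ballot a i) (tail i))) ⟩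
  ∑-antidiagonal (λ i j → ballot a i * ballot b j + tail i * ballot b j) n
    ≡⟨ ∑-antidiagonal-distrib-+ _ _ n ⟩
  (ballot a ⋆ ballot b) n + (tail ⋆ ballot b) n
    ≡⟨ cong₂ _+_ (ballot-⋆ n a b) (tail-⋆ n) ⟩
  ballot (suc (a + b)) n + tail′ n
    ≡⟨ split n ⟩
  ballot (suc (suc a + b)) n ∎
  where
  open ≡-Reasoning
  tail tail′ : ℕ → ℕ
  tail zero    = 0
  tail (suc j) = ballot (suc (suc a)) j
  tail′ zero    = 0
  tail′ (suc j) = ballot (suc (suc (suc a + b))) j
  peel : ∀ i → ballot (suc a) i ≡ ballot a i + tail i
  peel zero    = sym (trans (+-identityʳ (ballot a 0)) (ballot-zero a))
  peel (suc i) = refl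
  tail-⋆ : ∀ n → (tail ⋆ ballot b) n ≡ tail′ n
  tail-⋆ zero    = refl
  tail-⋆ (suc n) = ballot-⋆ n (suc (suc a)) b
  split : ∀ n → ballot (suc (a + b)) n + tail′ n ≡ ballot (suc (suc a + b)) n
  split zero    = refl
  split (suc n) = refl

cat : ℕ → ℕ
cat = ballot 0

cat-segner : ∀ n → cat (suc n) ≡ (cat ⋆ cat) n
cat-segner n = sym (ballot-⋆ n 0 0)

C-sym : ∀ a b → (a + b) C a ≡ (a + b) C b
C-sym a b = trans (nCk≡nC[n∸k] (m≤m+n a b)) (cong ((a + b) C_) (m+n∸m≡n a b))

pascal : ∀ n k → n C k + n C suc k ≡ suc n C suc k
pascal = nCk+nC[k+1]≡[n+1]C[k+1]

C-absorption : ∀ m k → suc k * (suc m C suc k) ≡ suc m * (m C k)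
C-absorption zero    zero    = refl
C-absorption zero    (suc k) rewrite k>n⇒nCk≡0 {1} {suc (suc k)} (s≤s (s≤s z≤n))
                               | k>n⇒nCk≡0 {0} {suc k} (s≤s z≤n) = *-zeroʳ (suc (suc k))
C-absorption (suc m) zero    rewrite nC1≡n (suc (suc m)) = *-comm 1 (suc (suc m))
C-absorption (suc m) (suc k) = begin
  suc (suc k) * (suc (suc m) C suc (suc k))
    ≡⟨ cong (suc (suc k) *_) (sym (pascal (suc m) (suc k))) ⟩
  suc (suc k) * (x + y)
    ≡⟨ regroup₁ k x y ⟩
  (suc k * x + x) + suc (suc k) * y
    ≡⟨ cong₂ (λ u v → (u + x) + v) (C-absorption m k) (C-absorption m (suc k)) ⟩
  (suc m * (m C k) + x) + suc m * (m C suc k)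
    ≡⟨ regroup₂ (suc m) (m C k) (m C suc k) x ⟩
  suc m * (m C k + m C suc k) + x
    ≡⟨ cong (λ u → suc m * u + x) (pascal m k) ⟩
  suc m * x + x
    ≡⟨ +-comm (suc m * x) x ⟩
  suc (suc m) * x ∎
  where
  open ≡-Reasoning
  x = suc m C suc k
  y = suc m C suc (suc k)
  regroup₁ : ∀ k x y → suc (suc k) * (x + y) ≡ (suc k * x + x) + suc (suc k) * y
  regroup₁ = solve-∀
  regroup₂ : ∀ a u v w → (a * u + w) + a * v ≡ a * (u + v) + w
  regroup₂ = solve-∀

ballot+C≡C : ∀ h n {N K} → n + h ≡ K → n + K ≡ N → ballot h n + N C suc K ≡ N C K
ballot+C≡C zero    zero    refl refl = refl
ballot+C≡C (suc h) zero    refl refl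
  rewrite k>n⇒nCk≡0 (n<1+n (suc h)) | nCn≡1 (suc h) = refl
ballot+C≡C zero    (suc n) refl refl = begin
  ballot 1 n + suc N C suc K       ≡⟨ cong (ballot 1 n +_) (sym (pascal N K)) ⟩
  ballot 1 n + (N C K + N C suc K) ≡⟨ cong (ballot 1 n +_) (+-comm (N C K) _) ⟩
  ballot 1 n + (N C suc K + N C K) ≡⟨ sym (+-assoc (ballot 1 n) _ _) ⟩
  ballot 1 n + N C suc K + N C K   ≡⟨ cong (_+ N C K) (ballot+C≡C 1 n (+-suc n 0) refl) ⟩
  N C K + N C K                    ≡⟨ cong (_+ N C K) (sym (C-sym n K)) ⟩
  N C n + N C K                    ≡⟨ cong (λ k → N C k + N C K) (sym (+-identityʳ n)) ⟩
  N C (n + 0) + N C K              ≡⟨ pascal N (n + 0) ⟩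
  suc N C K                        ∎
  where
  open ≡-Reasoning
  K = suc (n + 0)
  N = n + K
ballot+C≡C (suc h) (suc n) refl refl =
  step {N = n + (suc n + suc h)} {K = n + suc h}
       (ballot+C≡C h (suc n) (sym (+-suc n h)) (sym (+-suc n _)))
       (ballot+C≡C (suc (suc h)) n (+-suc n (suc h)) refl)
  where
  step : ∀ {a b N K} → a + N C suc K ≡ N C K → b + N C suc (suc K) ≡ N C suc K →
         (a + b) + suc N C suc (suc K) ≡ suc N C suc K
  step {a} {b} {N} {K} eq₁ eq₂ = begin
    (a + b) + suc N C suc (suc K)                   ≡⟨ cong (a + b +_) (sym (pascal N (suc K))) ⟩
    (a + b) + (N C suc K + N C suc (suc K))         ≡⟨ +-interchange a b _ _ ⟩
    (a + N C suc K) + (b + N C suc (suc K))         ≡⟨ cong₂ _+_ eq₁ eq₂ ⟩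
    N C K + N C suc K                               ≡⟨ pascal N K ⟩
    suc N C suc K                                   ∎
    where open ≡-Reasoning

central-C-absorption : ∀ n → suc n * ((n + n) C suc n) ≡ n * ((n + n) C n)
central-C-absorption zero     = refl
central-C-absorption (suc k) = begin
  suc (suc k) * (suc m C suc (suc k)) ≡⟨ C-absorption m (suc k) ⟩
  suc m * (m C suc k)                 ≡⟨ cong (suc m *_) (sym (C-sym k (suc k))) ⟩
  suc m * (m C k)                     ≡⟨ sym (C-absorption m k) ⟩
  suc k * (suc m C suc k)             ∎
  where
  open ≡-Reasoning
  m = k + suc k

suc-*-cat≡C : ∀ n → suc n * cat n ≡ (n + n) C n
suc-*-cat≡C n = +-cancelʳ-≡ (n * Y) (suc n * cat n) Y (begin
  suc n * cat n + n * Y       ≡⟨ cong (suc n * cat n +_) (sym (central-C-absorption n)) ⟩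
  suc n * cat n + suc n * Z   ≡⟨ sym (*-distribˡ-+ (suc n) (cat n) Z) ⟩
  suc n * (cat n + Z)         ≡⟨ cong (suc n *_) (ballot+C≡C 0 n (+-identityʳ n) refl) ⟩
  Y + n * Y                   ∎)
  where
  open ≡-Reasoning
  Y = (n + n) C n
  Z = (n + n) C suc n

catalan≡cat : ∀ n → catalan n ≡ cat n
catalan≡cat n = begin
  ((2 * n) C n) / suc n    ≡⟨ cong (λ k → ((n + k) C n) / suc n) (+-identityʳ n) ⟩
  ((n + n) C n) / suc n    ≡⟨ cong (_/ suc n) (trans (sym (suc-*-cat≡C n)) (*-comm (suc n) (cat n))) ⟩
  (cat n * suc n) / suc n  ≡⟨ m*n/n≡m (cat n) (suc n) ⟩
  cat n                    ∎
  where open ≡-Reasoning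

⋆-*-≤ : ∀ a b f g c → (∀ t → t < a → g (suc t) * c ≤ g (suc t + b)) →
        f a * g 0 * c ≤ f (a + b) * g 0 → (f ⋆ g) a * c ≤ (f ⋆ g) (a + b)
⋆-*-≤ zero    b f g c _     last = ≤-trans last (∑-antidiagonal-last (λ i j → f i * g j) b)
⋆-*-≤ (suc a) b f g c inner last = begin
  (f 0 * g (suc a) + ((f ∘ suc) ⋆ g) a) * c
    ≡⟨ *-distribʳ-+ c (f 0 * g (suc a)) _ ⟩
  f 0 * g (suc a) * c + ((f ∘ suc) ⋆ g) a * c
    ≡⟨ cong (_+ ((f ∘ suc) ⋆ g) a * c) (*-assoc (f 0) (g (suc a)) c) ⟩
  f 0 * (g (suc a) * c) + ((f ∘ suc) ⋆ g) a * c
    ≤⟨ +-mono-≤ (*-monoʳ-≤ (f 0) (inner a ≤-refl))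
                (⋆-*-≤ a b (f ∘ suc) g c (λ t t<a → inner t (m<n⇒m<1+n t<a)) last) ⟩
  f 0 * g (suc a + b) + ((f ∘ suc) ⋆ g) (a + b) ∎
  where open ≤-Reasoning

cat-mono : ∀ n → cat n ≤ cat (suc n)
cat-mono n = begin
  cat n             ≡⟨ sym (*-identityʳ (cat n)) ⟩
  cat n * cat 0     ≤⟨ ∑-antidiagonal-last (λ i j → cat i * cat j) n ⟩
  (cat ⋆ cat) n     ≡⟨ sym (cat-segner n) ⟩
  cat (suc n)       ∎
  where open ≤-Reasoning

cat-suc-*-≤ : ∀ a b → cat (suc a) * cat (suc b) ≤ cat (suc (a + b))
cat-suc-*-≤ = <-rec _ go
  where
  go : ∀ a → (∀ {t} → t < a → ∀ b → cat (suc t) * cat (suc b) ≤ cat (suc (t + b))) →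
       ∀ b → cat (suc a) * cat (suc b) ≤ cat (suc (a + b))
  go zero    _  b = ≤-reflexive (+-identityʳ (cat (suc b)))
  go (suc a) ih b = begin
    cat (suc (suc a)) * cat (suc b)  ≡⟨ cong (_* cat (suc b)) (cat-segner (suc a)) ⟩
    (cat ⋆ cat) (suc a) * cat (suc b) ≤⟨ ⋆-*-≤ (suc a) b cat cat (cat (suc b)) (λ t t<a → ih t<a b) last ⟩
    (cat ⋆ cat) (suc a + b)          ≡⟨ sym (cat-segner (suc a + b)) ⟩
    cat (suc (suc a + b))            ∎
    where
    open ≤-Reasoning
    last : cat (suc a) * 1 * cat (suc b) ≤ cat (suc a + b) * 1
    last rewrite *-identityʳ (cat (suc a)) | *-identityʳ (cat (suc a + b)) = ih ≤-refl b

cat-*-≤ : ∀ x y → cat x * cat y ≤ cat (x + y)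
cat-*-≤ zero    y       = ≤-reflexive (+-identityʳ (cat y))
cat-*-≤ (suc a) zero    rewrite *-identityʳ (cat (suc a)) | +-identityʳ a = ≤-refl
cat-*-≤ (suc a) (suc b) = begin
  cat (suc a) * cat (suc b) ≤⟨ cat-suc-*-≤ a b ⟩
  cat (suc (a + b))         ≤⟨ cat-mono (suc (a + b)) ⟩
  cat (suc (suc (a + b)))   ≡⟨ cong (cat ∘ suc) (sym (+-suc a b)) ⟩
  cat (suc a + suc b)       ∎
  where open ≤-Reasoning

data Parity : ℕ → Set where
  even : ∀ x → Parity (x + x)
  odd  : ∀ x → Parity (suc (x + x))

parity : ∀ n → Parity n
parity zero    = even 0
parity (suc n) with parity n
... | even x = odd x
... | odd  x rewrite sym (+-suc x x) = even (suc x)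

aerate : (ℕ → ℕ) → ℕ → ℕ
aerate f zero          = f 0
aerate f (suc zero)    = 0
aerate f (suc (suc n)) = aerate (f ∘ suc) n

aerate-even : ∀ f x → aerate f (x + x) ≡ f x
aerate-even f zero    = refl
aerate-even f (suc x) rewrite +-suc x x = aerate-even (f ∘ suc) x

aerate-odd : ∀ f x → aerate f (suc (x + x)) ≡ 0
aerate-odd f zero    = refl
aerate-odd f (suc x) rewrite +-suc x x = aerate-odd (f ∘ suc) x

aerate-cong : ∀ {f g} → (∀ n → f n ≡ g n) → ∀ n → aerate f n ≡ aerate g n
aerate-cong f≡g zero          = f≡g 0
aerate-cong f≡g (suc zero)    = refl
aerate-cong f≡g (suc (suc n)) = aerate-cong (f≡g ∘ suc) n

⋆-aerate-even : ∀ f g x → (aerate f ⋆ aerate g) (x + x) ≡ (f ⋆ g) x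
⋆-aerate-even f g zero    = refl
⋆-aerate-even f g (suc x) rewrite +-suc x x =
  cong₂ (λ u v → f 0 * u + v) (aerate-even (g ∘ suc) x) (⋆-aerate-even (f ∘ suc) g x)

⋆-aerate-odd : ∀ f g x → (aerate f ⋆ aerate g) (suc (x + x)) ≡ 0
⋆-aerate-odd f g zero    = trans (+-identityʳ (f 0 * 0)) (*-zeroʳ (f 0))
⋆-aerate-odd f g (suc x) rewrite +-suc x x | aerate-odd (g ∘ suc) x | ⋆-aerate-odd (f ∘ suc) g x =
  trans (+-identityʳ (f 0 * 0)) (*-zeroʳ (f 0))

aerate-⋆ : ∀ f g n → (aerate f ⋆ aerate g) n ≡ aerate (f ⋆ g) n
aerate-⋆ f g n with parity n
... | even x = trans (⋆-aerate-even f g x) (sym (aerate-even (f ⋆ g) x))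
... | odd  x = trans (⋆-aerate-odd f g x) (sym (aerate-odd (f ⋆ g) x))

-- matchings n: number of non-crossing perfect matchings of n points on a line
matchings : ℕ → ℕ
matchings = aerate cat

matchings-segner : ∀ n → (matchings ⋆ matchings) n ≡ matchings (suc (suc n))
matchings-segner n = trans (aerate-⋆ cat cat n) (sym (aerate-cong cat-segner n))

matchings-*-≤ : ∀ u v → matchings u * matchings v ≤ matchings (u + v)
matchings-*-≤ u v with parity u | parity v
... | odd x  | _      rewrite aerate-odd cat x = z≤n
... | even x | odd y  rewrite aerate-odd cat y | *-zeroʳ (matchings (x + x)) = z≤n
... | even x | even y rewrite aerate-even cat x | aerate-even cat y =
  subst (cat x * cat y ≤_) (sym matchings-sum) (cat-*-≤ x y)
  where
  matchings-sum : matchings ((x + x) + (y + y)) ≡ cat (x + y)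
  matchings-sum = trans (cong matchings (+-interchange x x y y)) (aerate-even cat (x + y))

matchings-suc-*-≤ : ∀ t f → matchings (suc t) * matchings (suc f) ≤ matchings (t + f)
matchings-suc-*-≤ t f with parity t | parity f
... | even x | _      rewrite aerate-odd cat x = z≤n
... | odd x  | even y rewrite aerate-odd cat y | *-zeroʳ (matchings (suc (suc (x + x)))) = z≤n
... | odd x  | odd y  rewrite aerate-even (cat ∘ suc) x | aerate-even (cat ∘ suc) y =
  subst (cat (suc x) * cat (suc y) ≤_) (sym matchings-sum) (cat-suc-*-≤ x y)
  where
  regroup : ∀ x y → suc (x + x) + suc (y + y) ≡ suc (suc ((x + y) + (x + y)))
  regroup = solve-∀
  matchings-sum : matchings (suc (x + x) + suc (y + y)) ≡ cat (suc (x + y))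
  matchings-sum = trans (cong matchings (regroup x y)) (aerate-even (cat ∘ suc) (x + y))

δ : Bool → Bool → ℕ
δ true  true  = 1
δ false false = 1
δ _     _     = 0

δ-≡ : ∀ {x y} → x ≡ y → δ x y ≡ 1
δ-≡ {true}  refl = refl
δ-≡ {false} refl = refl

δ-≢ : ∀ {x y} → x ≢ y → δ x y ≡ 0
δ-≢ {true}  {true}  x≢y = ⊥-elim (x≢y refl)
δ-≢ {true}  {false} _   = refl
δ-≢ {false} {true}  _   = refl
δ-≢ {false} {false} x≢y = ⊥-elim (x≢y refl)

δ≡0⇒≡not : ∀ x y → δ x y ≡ 0 → x ≡ not y
δ≡0⇒≡not true  false _ = refl
δ≡0⇒≡not false true  _ = refl

δ-not : ∀ x → δ x (not x) ≡ 0
δ-not true  = refl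
δ-not false = refl

δ-true+false : ∀ x → δ x true + δ x false ≡ 1
δ-true+false true  = refl
δ-true+false false = refl

module Colouring (colour : ℕ → Bool) where

  count : Bool → ℕ → ℕ → ℕ
  count b s zero    = 0
  count b s (suc L) = δ (colour s) b + count b (suc s) L

  count-+ : ∀ b s L M → count b s (L + M) ≡ count b s L + count b (s + L) M
  count-+ b s zero    M = cong (λ s′ → count b s′ M) (sym (+-identityʳ s))
  count-+ b s (suc L) M = begin
    δ (colour s) b + count b (suc s) (L + M)
      ≡⟨ cong (δ (colour s) b +_) (count-+ b (suc s) L M) ⟩
    δ (colour s) b + (count b (suc s) L + count b (suc s + L) M)
      ≡⟨ sym (+-assoc (δ (colour s) b) _ _) ⟩
    δ (colour s) b + count b (suc s) L + count b (suc s + L) M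
      ≡⟨ cong (λ s′ → δ (colour s) b + count b (suc s) L + count b s′ M) (sym (+-suc s L)) ⟩
    δ (colour s) b + count b (suc s) L + count b (s + suc L) M ∎
    where open ≡-Reasoning

  count-true+false : ∀ s L → count true s L + count false s L ≡ L
  count-true+false s zero    = refl
  count-true+false s (suc L) = begin
    (δ (colour s) true + count true (suc s) L) + (δ (colour s) false + count false (suc s) L)
      ≡⟨ +-interchange (δ (colour s) true) _ _ _ ⟩
    (δ (colour s) true + δ (colour s) false) + (count true (suc s) L + count false (suc s) L)
      ≡⟨ cong₂ _+_ (δ-true+false (colour s)) (count-true+false (suc s) L) ⟩
    suc L ∎
    where open ≡-Reasoning

  count≡0 : ∀ b s L → count b s L ≡ 0 → ∀ p → s ≤ p → p < s + L → colour p ≡ not b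
  count≡0 b s zero    _  p s≤p p<s+0 = ⊥-elim (<⇒≱ p<s+0 (subst (_≤ p) (sym (+-identityʳ s)) s≤p))
  count≡0 b s (suc L) eq p s≤p p<s+L with p ≟ s
  ... | yes refl = δ≡0⇒≡not (colour s) b (m+n≡0⇒m≡0 _ eq)
  ... | no  p≢s  = count≡0 b (suc s) L (m+n≡0⇒n≡0 _ eq) p (≤∧≢⇒< s≤p (p≢s ∘ sym))
                           (subst (p <_) (+-suc s L) p<s+L)

  -- splitSum b g h s L = Σ over b-coloured p ∈ [s, s + L) of
  --   g (#b-coloured points in [s, p)) * h (#b-coloured points in (p, s + L))
  splitSum : Bool → (ℕ → ℕ) → (ℕ → ℕ) → ℕ → ℕ → ℕ
  splitSum b g h s zero    = 0
  splitSum b g h s (suc L) =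
    δ (colour s) b * (g 0 * h (count b (suc s) L)) + splitSum b (λ v → g (δ (colour s) b + v)) h (suc s) L

  splitSum-zero : ∀ b g h s L → count b s L ≡ 0 → splitSum b g h s L ≡ 0
  splitSum-zero b g h s zero    _  = refl
  splitSum-zero b g h s (suc L) eq rewrite m+n≡0⇒m≡0 (δ (colour s) b) eq =
    splitSum-zero b g h (suc s) L (m+n≡0⇒n≡0 (δ (colour s) b) eq)

  splitSum-⋆ : ∀ b g h s L k → count b s L ≡ suc k → splitSum b g h s L ≡ (g ⋆ h) k
  splitSum-⋆ b g h s (suc L) k eq with colour s ≟ᵇ b
  ... | no  c≢b rewrite δ-≢ c≢b = splitSum-⋆ b g h (suc s) L k eq
  ... | yes c≡b rewrite δ-≡ c≡b | +-identityʳ (g 0 * h (count b (suc s) L)) = first+rest k (suc-injective eq)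
    where
    first+rest : ∀ k → count b (suc s) L ≡ k →
                 g 0 * h (count b (suc s) L) + splitSum b (g ∘ suc) h (suc s) L ≡ (g ⋆ h) k
    first+rest zero    eq rewrite eq | splitSum-zero b (g ∘ suc) h (suc s) L eq = +-identityʳ (g 0 * h 0)
    first+rest (suc k) eq rewrite eq = cong (g 0 * h (suc k) +_) (splitSum-⋆ b (g ∘ suc) h (suc s) L k eq)

  splitSum-matchings : ∀ b s L → splitSum b matchings matchings s L ≤ matchings (suc (count b s L))
  splitSum-matchings b s L with count b s L in eq
  ... | zero  = ≤-reflexive (splitSum-zero b matchings matchings s L eq)
  ... | suc k = ≤-reflexive (trans (splitSum-⋆ b matchings matchings s L k eq) (matchings-segner k))

  splitSum-drop : ∀ b g h s L →
    splitSum b (λ v → g (δ (colour s) b + v)) h (suc s) L ≤ splitSum b g h s (suc L)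
  splitSum-drop b g h s L = m≤n+m _ _

  splitSum-alternate : ∀ b g h a e →
    ∑-antidiagonal (λ i j → δ (colour (a + (i + i))) b *
                             (g (count b a (i + i)) * h (count b (suc (a + (i + i))) (j + j)))) e
      ≤ splitSum b g h a (suc (e + e))
  splitSum-alternate b g h a zero    rewrite +-identityʳ a = ≤-reflexive (sym (+-identityʳ _))
  splitSum-alternate b g h a (suc e) rewrite +-identityʳ a = +-monoʳ-≤ _ (begin
    ∑-antidiagonal (λ i j → δ (colour (a + (suc i + suc i))) b *
                             (g (count b a (suc i + suc i)) * h (count b (suc (a + (suc i + suc i))) (j + j)))) e
      ≡⟨ ∑-antidiagonal-cong e (λ i j _ → shift i j) ⟩
    ∑-antidiagonal (λ i j → δ (colour (suc (suc a) + (i + i))) b *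
                             (g₂ (count b (suc (suc a)) (i + i)) * h (count b (suc (suc (suc a) + (i + i))) (j + j)))) e
      ≤⟨ splitSum-alternate b g₂ h (suc (suc a)) e ⟩
    splitSum b g₂ h (suc (suc a)) (suc (e + e))
      ≡⟨ cong (splitSum b g₂ h (suc (suc a))) (sym (+-suc e e)) ⟩
    splitSum b g₂ h (suc (suc a)) (e + suc e)
      ≤⟨ splitSum-drop b g₁ h (suc a) (e + suc e) ⟩
    splitSum b g₁ h (suc a) (suc e + suc e) ∎)
    where
    open ≤-Reasoning
    g₁ g₂ : ℕ → ℕ
    g₁ v = g (δ (colour a) b + v)
    g₂ v = g₁ (δ (colour (suc a)) b + v)
    position : ∀ a i → a + (suc i + suc i) ≡ suc (suc a) + (i + i)
    position = solve-∀
    shift : ∀ i j →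
      δ (colour (a + (suc i + suc i))) b *
        (g (count b a (suc i + suc i)) * h (count b (suc (a + (suc i + suc i))) (j + j)))
      ≡ δ (colour (suc (suc a) + (i + i))) b *
          (g₂ (count b (suc (suc a)) (i + i)) * h (count b (suc (suc (suc a) + (i + i))) (j + j)))
    shift i j rewrite position a i | +-suc i i = refl

  colouredMatchings : ℕ → ℕ → ℕ
  colouredMatchings s L = matchings (count true s L) * matchings (count false s L)

  colouredMatchings-swap : ∀ b s L →
    colouredMatchings s L ≡ matchings (count b s L) * matchings (count (not b) s L)
  colouredMatchings-swap true  s L = refl
  colouredMatchings-swap false s L = *-comm (matchings (count true s L)) _

  colouredMatchings-bicoloured : ∀ s L t f → count true s L ≡ suc t → count false s L ≡ suc f →
    colouredMatchings s L ≤ matchings (t + f)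
  colouredMatchings-bicoloured s L t f T≡ F≡ rewrite T≡ | F≡ = matchings-suc-*-≤ t f

  colouredMatchings-≤-cat : ∀ s n′ f → colour s ≡ true → count false s (suc n′ + suc n′) ≡ suc f →
    colouredMatchings s (suc n′ + suc n′) ≤ cat n′
  colouredMatchings-≤-cat s n′ f colour-s F≡ = begin
    colouredMatchings s L  ≤⟨ colouredMatchings-bicoloured s L t f T≡ F≡ ⟩
    matchings (t + f)      ≡⟨ cong matchings t+f≡ ⟩
    matchings (n′ + n′)    ≡⟨ aerate-even cat n′ ⟩
    cat n′                 ∎
    where
    open ≤-Reasoning
    L = suc n′ + suc n′
    t = count true (suc s) (n′ + suc n′)
    T≡ : count true s L ≡ suc t
    T≡ = cong (λ b → δ b true + t) colour-s
    t+f≡ : t + f ≡ n′ + n′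
    t+f≡ = suc-injective (suc-injective (begin-equality
      suc (suc (t + f))                  ≡⟨ cong suc (sym (+-suc t f)) ⟩
      suc t + suc f                      ≡⟨ cong₂ _+_ (sym T≡) (sym F≡) ⟩
      count true s L + count false s L   ≡⟨ count-true+false s L ⟩
      L                                  ≡⟨ cong suc (+-suc n′ n′) ⟩
      suc (suc (n′ + n′))                ∎))

  count-decompose : ∀ b s i j → count b s (suc (i + j) + suc (i + j)) ≡
    δ (colour s) b + (count b (suc s) (i + i) +
      (δ (colour (suc s + (i + i))) b + count b (suc (suc s + (i + i))) (j + j)))
  count-decompose b s i j =
    trans (cong (count b s) (regroup i j)) (cong (δ (colour s) b +_) (count-+ b (suc s) (i + i) (suc (j + j))))
    where
    regroup : ∀ i j → suc (i + j) + suc (i + j) ≡ suc ((i + i) + suc (j + j))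
    regroup = solve-∀

  colouredMatchings-root-≤ : ∀ s i j → colour (suc s + (i + i)) ≡ colour s →
    colouredMatchings (suc s) (i + i) * colouredMatchings (suc (suc s + (i + i))) (j + j)
      ≤ matchings (count (not (colour s)) s (suc (i + j) + suc (i + j))) *
          (matchings (count (colour s) (suc s) (i + i)) *
           matchings (count (colour s) (suc (suc s + (i + i))) (j + j)))
  colouredMatchings-root-≤ s i j c≡b = begin
    colouredMatchings (suc s) (i + i) * colouredMatchings s′ (j + j)
      ≡⟨ cong₂ _*_ (colouredMatchings-swap b (suc s) (i + i)) (colouredMatchings-swap b s′ (j + j)) ⟩
    (M tA * M fA) * (M tB * M fB)  ≡⟨ rearrange (M tA) (M fA) (M tB) (M fB) ⟩
    (M fA * M fB) * (M tA * M tB)  ≤⟨ *-monoˡ-≤ (M tA * M tB) (matchings-*-≤ fA fB) ⟩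
    M (fA + fB) * (M tA * M tB)    ≡⟨ cong (λ f → M f * (M tA * M tB)) (sym F≡fA+fB) ⟩
    M F * (M tA * M tB)            ∎
    where
    open ≤-Reasoning
    M = matchings
    b = colour s
    s′ = suc (suc s + (i + i))
    tA = count b (suc s) (i + i)
    fA = count (not b) (suc s) (i + i)
    tB = count b s′ (j + j)
    fB = count (not b) s′ (j + j)
    F = count (not b) s (suc (i + j) + suc (i + j))
    rearrange : ∀ a b c d → (a * b) * (c * d) ≡ (b * d) * (a * c)
    rearrange = solve-∀
    F≡fA+fB : F ≡ fA + fB
    F≡fA+fB = begin-equality
      F                                                                  ≡⟨ count-decompose (not b) s i j ⟩
      δ b (not b) + (fA + (δ (colour (suc s + (i + i))) (not b) + fB))   ≡⟨ cong (λ c → δ b (not b) + (fA + (δ c (not b) + fB))) c≡b ⟩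
      δ b (not b) + (fA + (δ b (not b) + fB))                            ≡⟨ cong (λ z → z + (fA + (z + fB))) (δ-not b) ⟩
      fA + fB                                                            ∎

  colouredMatchings-step : ∀ (N : ℕ → ℕ → ℕ) → (∀ s e → N s e ≤ colouredMatchings s (e + e)) → ∀ s e →
    ∑-antidiagonal (λ i j → δ (colour (s + 2 * i + 1)) (colour s) * (N (suc s) i * N (s + 2 * i + 2) j)) e
      ≤ colouredMatchings s (suc e + suc e)
  colouredMatchings-step N N≤ s e = begin
    ∑-antidiagonal (λ i j → δ (colour (s + 2 * i + 1)) b * (N (suc s) i * N (s + 2 * i + 2) j)) e
      ≤⟨ ∑-antidiagonal-mono-≤ e term-≤ ⟩
    ∑-antidiagonal (λ i j → M F * alternating i j) e
      ≡⟨ sym (∑-antidiagonal-*ˡ (M F) alternating e) ⟩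
    M F * ∑-antidiagonal alternating e
      ≤⟨ *-monoʳ-≤ (M F) (splitSum-alternate b M M (suc s) e) ⟩
    M F * splitSum b M M (suc s) (suc (e + e))
      ≤⟨ *-monoʳ-≤ (M F) (splitSum-matchings b (suc s) (suc (e + e))) ⟩
    M F * M (suc (count b (suc s) (suc (e + e))))
      ≡⟨ cong (λ t → M F * M t) (sym count-b) ⟩
    M F * M (count b s (suc e + suc e))
      ≡⟨ *-comm (M F) _ ⟩
    M (count b s (suc e + suc e)) * M F
      ≡⟨ sym (colouredMatchings-swap b s (suc e + suc e)) ⟩
    colouredMatchings s (suc e + suc e) ∎
    where
    open ≤-Reasoning
    M = matchings
    b = colour s
    F = count (not b) s (suc e + suc e)
    alternating : ℕ → ℕ → ℕ
    alternating i j = δ (colour (suc s + (i + i))) b *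
                        (M (count b (suc s) (i + i)) * M (count b (suc (suc s + (i + i))) (j + j)))
    count-b : count b s (suc e + suc e) ≡ suc (count b (suc s) (suc (e + e)))
    count-b = cong₂ _+_ (δ-≡ refl) (cong (count b (suc s)) (+-suc e e))
    label₁ : ∀ s i → s + 2 * i + 1 ≡ suc s + (i + i)
    label₁ = solve-∀
    label₂ : ∀ s i → s + 2 * i + 2 ≡ suc (suc s + (i + i))
    label₂ = solve-∀
    term-≤ : ∀ i j → i + j ≡ e →
      δ (colour (s + 2 * i + 1)) b * (N (suc s) i * N (s + 2 * i + 2) j) ≤ M F * alternating i j
    term-≤ i j i+j≡e rewrite label₁ s i | label₂ s i with colour (suc s + (i + i)) ≟ᵇ b
    ... | no  c≢b rewrite δ-≢ c≢b = z≤n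
    ... | yes c≡b rewrite δ-≡ c≡b | sym i+j≡e = begin
      1 * (N (suc s) i * N s′ j)       ≡⟨ *-identityˡ _ ⟩
      N (suc s) i * N s′ j             ≤⟨ *-mono-≤ (N≤ (suc s) i) (N≤ s′ j) ⟩
      colouredMatchings (suc s) (i + i) * colouredMatchings s′ (j + j)
                                       ≤⟨ colouredMatchings-root-≤ s i j c≡b ⟩
      M F′ * (M tA * M tB)             ≡⟨ cong (M F′ *_) (sym (*-identityˡ _)) ⟩
      M F′ * (1 * (M tA * M tB))       ∎
      where
      s′ = suc (suc s + (i + i))
      tA = count b (suc s) (i + i)
      tB = count b s′ (j + j)
      F′ = count (not b) s (suc (i + j) + suc (i + j))

concat-antidiagonal : ∀ {A : Set} → (ℕ → ℕ → List A) → ℕ → List A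
concat-antidiagonal G zero    = G 0 0
concat-antidiagonal G (suc n) = G 0 (suc n) ++ concat-antidiagonal (G ∘ suc) n

module _ {A : Set} where

  length-concat-antidiagonal : ∀ (G : ℕ → ℕ → List A) n →
    length (concat-antidiagonal G n) ≡ ∑-antidiagonal (λ i j → length (G i j)) n
  length-concat-antidiagonal G zero    = refl
  length-concat-antidiagonal G (suc n) =
    trans (length-++ (G 0 (suc n))) (cong (length (G 0 (suc n)) +_) (length-concat-antidiagonal (G ∘ suc) n))

  ∈-concat-antidiagonal⁺ : ∀ {G : ℕ → ℕ → List A} {x} i j → x ∈ G i j → x ∈ concat-antidiagonal G (i + j)
  ∈-concat-antidiagonal⁺ zero    zero    x∈ = x∈
  ∈-concat-antidiagonal⁺ zero    (suc j) x∈ = ∈-++⁺ˡ x∈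
  ∈-concat-antidiagonal⁺ {G} (suc i) j x∈ = ∈-++⁺ʳ (G 0 (suc (i + j))) (∈-concat-antidiagonal⁺ {G ∘ suc} i j x∈)

  ∈-concat-antidiagonal⁻ : ∀ (G : ℕ → ℕ → List A) {x} n → x ∈ concat-antidiagonal G n →
                           ∃₂ λ i j → i + j ≡ n × x ∈ G i j
  ∈-concat-antidiagonal⁻ G zero    x∈ = 0 , 0 , refl , x∈
  ∈-concat-antidiagonal⁻ G (suc n) x∈ with ∈-++⁻ (G 0 (suc n)) x∈
  ... | inj₁ x∈G = 0 , suc n , refl , x∈G
  ... | inj₂ x∈rest with ∈-concat-antidiagonal⁻ (G ∘ suc) n x∈rest
  ...   | i , j , i+j≡n , x∈G = suc i , j , cong suc i+j≡n , x∈G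

  concat-antidiagonal-unique : ∀ (G : ℕ → ℕ → List A) → (∀ i j → Unique (G i j)) →
    (∀ {x} i j i′ j′ → x ∈ G i j → x ∈ G i′ j′ → i ≡ i′) →
    ∀ n → Unique (concat-antidiagonal G n)
  concat-antidiagonal-unique G unique separated zero    = unique 0 0
  concat-antidiagonal-unique G unique separated (suc n) =
    Unique.++⁺ (unique 0 (suc n))
               (concat-antidiagonal-unique (G ∘ suc) (unique ∘ suc) (λ i j i′ j′ p q → suc-injective (separated (suc i) j (suc i′) j′ p q)) n)
               disjoint
    where
    disjoint : ∀ {x} → ¬ (x ∈ G 0 (suc n) × x ∈ concat-antidiagonal (G ∘ suc) n)
    disjoint (x∈head , x∈rest) with ∈-concat-antidiagonal⁻ (G ∘ suc) n x∈rest
    ... | i , j , _ , x∈G = 0≢1+n (separated 0 (suc n) (suc i) j x∈head x∈G)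

length-cartesianProductWith : ∀ {A B C : Set} (f : A → B → C) xs ys →
  length (cartesianProductWith f xs ys) ≡ length xs * length ys
length-cartesianProductWith f []       ys = refl
length-cartesianProductWith f (x ∷ xs) ys =
  trans (length-++ (Data.List.map (f x) ys))
        (cong₂ _+_ (length-map (f x) ys) (length-cartesianProductWith f xs ys))

node-injective : ∀ {cs cs′} → node cs ≡ node cs′ → cs ≡ cs′
node-injective refl = refl

module Forests {R : ℕ × ℕ → Set} (R? : ∀ e → Dec (R e)) where

  ValidForest : ℕ → List PlaneTree → Set
  ValidForest s ts = All R (edgePairsF s ts)

  -- forests f s e lists the forests with e edges whose edges, labelled from s on, all satisfy R;
  -- the fuel f ≥ e only serves termination.
  forests : ℕ → ℕ → ℕ → List (List PlaneTree)
  rooted  : ℕ → ℕ → ℕ → ℕ → List (List PlaneTree)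
  forests f       s zero    = [] ∷ []
  forests zero    s (suc e) = []
  forests (suc f) s (suc e) = concat-antidiagonal (rooted f s) e
  rooted f s i j =
    if does (R? (s , s + 2 * i + 1))
    then cartesianProductWith (λ cs ts → node cs ∷ ts) (forests f (suc s) i) (forests f (s + 2 * i + 2) j)
    else []

  ∈-rooted⁻ : ∀ f s i j {x} → x ∈ rooted f s i j →
    ∃₂ λ cs ts → x ≡ node cs ∷ ts × cs ∈ forests f (suc s) i × ts ∈ forests f (s + 2 * i + 2) j ×
                 R (s , s + 2 * i + 1)
  ∈-rooted⁻ f s i j x∈ with R? (s , s + 2 * i + 1)
  ... | yes r with ∈-cartesianProductWith⁻ _ (forests f (suc s) i) (forests f (s + 2 * i + 2) j) x∈
  ...   | cs , ts , cs∈ , ts∈ , x≡ = cs , ts , x≡ , cs∈ , ts∈ , r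

  forests-sound : ∀ f s e {ts} → ts ∈ forests f s e → edgesF ts ≡ e × ValidForest s ts
  forests-sound f       s zero    (here refl) = refl , []
  forests-sound (suc f) s (suc e) x∈
    with ∈-concat-antidiagonal⁻ (rooted f s) e x∈
  ... | i , j , i+j≡e , x∈rooted with ∈-rooted⁻ f s i j x∈rooted
  ...   | cs , ts , refl , cs∈ , ts∈ , r
    with forests-sound f (suc s) i cs∈ | forests-sound f (s + 2 * i + 2) j ts∈
  ...     | refl , valid-cs | refl , valid-ts =
    cong suc i+j≡e , r ∷ All.++⁺ valid-cs valid-ts

  forests-complete : ∀ f s ts → edgesF ts ≤ f → ValidForest s ts → ts ∈ forests f s (edgesF ts)
  forests-complete f       s []              _       _           = here refl
  forests-complete (suc f) s (node cs ∷ ts) (s≤s le) (r ∷ valid) =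
    ∈-concat-antidiagonal⁺ (edgesF cs) (edgesF ts) ∈rooted
    where
    valid-parts = All.++⁻ (edgePairsF (suc s) cs) valid
    ∈rooted : node cs ∷ ts ∈ rooted f s (edgesF cs) (edgesF ts)
    ∈rooted rewrite dec-true (R? (s , s + 2 * edgesF cs + 1)) r =
      ∈-cartesianProductWith⁺ _
        (forests-complete f (suc s) cs (≤-trans (m≤m+n _ _) le) (proj₁ valid-parts))
        (forests-complete f _ ts (≤-trans (m≤n+m _ _) le) (proj₂ valid-parts))

  forests-unique : ∀ f s e → Unique (forests f s e)
  forests-unique f       s zero    = [] ∷ []
  forests-unique zero    s (suc e) = []
  forests-unique (suc f) s (suc e) = concat-antidiagonal-unique (rooted f s) rooted-unique separated e
    where
    rooted-unique : ∀ i j → Unique (rooted f s i j)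
    rooted-unique i j with R? (s , s + 2 * i + 1)
    ... | yes _ = Unique.cartesianProductWith⁺ _
                    (λ eq → node-injective (∷-injectiveˡ eq) , ∷-injectiveʳ eq)
                    (forests-unique f (suc s) i) (forests-unique f (s + 2 * i + 2) j)
    ... | no  _ = []
    separated : ∀ {x} i j i′ j′ → x ∈ rooted f s i j → x ∈ rooted f s i′ j′ → i ≡ i′
    separated i j i′ j′ x∈ x∈′
      with ∈-rooted⁻ f s i j x∈ | ∈-rooted⁻ f s i′ j′ x∈′
    ... | cs , _ , refl , cs∈ , _ | cs′ , _ , eq , cs′∈ , _ =
      trans (sym (proj₁ (forests-sound f (suc s) i cs∈)))
            (trans (cong edgesF (node-injective (∷-injectiveˡ eq))) (proj₁ (forests-sound f (suc s) i′ cs′∈)))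

  length-rooted : ∀ f s i j → R (s , s + 2 * i + 1) →
    length (rooted f s i j) ≡ length (forests f (suc s) i) * length (forests f (s + 2 * i + 2) j)
  length-rooted f s i j r rewrite dec-true (R? (s , s + 2 * i + 1)) r =
    length-cartesianProductWith _ (forests f (suc s) i) (forests f (s + 2 * i + 2) j)

  forests-≤-colouredMatchings : ∀ (colour : ℕ → Bool) →
    (∀ s d → R (s , s + 2 * d + 1) → colour s ≡ colour (s + 2 * d + 1)) →
    ∀ f s e → length (forests f s e) ≤ Colouring.colouredMatchings colour s (e + e)
  forests-≤-colouredMatchings colour monochrome = bound
    where
    open Colouring colour
    bound : ∀ f s e → length (forests f s e) ≤ colouredMatchings s (e + e)
    bound f       s zero    = ≤-refl
    bound zero    s (suc e) = z≤n
    bound (suc f) s (suc e) = begin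
      length (forests (suc f) s (suc e))
        ≡⟨ length-concat-antidiagonal (rooted f s) e ⟩
      ∑-antidiagonal (λ i j → length (rooted f s i j)) e
        ≤⟨ ∑-antidiagonal-mono-≤ e (λ i j _ → rooted-≤ i j) ⟩
      ∑-antidiagonal (λ i j → δ (colour (s + 2 * i + 1)) (colour s) * (N (suc s) i * N (s + 2 * i + 2) j)) e
        ≤⟨ colouredMatchings-step N (bound f) s e ⟩
      colouredMatchings s (suc e + suc e) ∎
      where
      open ≤-Reasoning
      N : ℕ → ℕ → ℕ
      N s e = length (forests f s e)
      rooted-≤ : ∀ i j → length (rooted f s i j) ≤
                         δ (colour (s + 2 * i + 1)) (colour s) * (N (suc s) i * N (s + 2 * i + 2) j)
      rooted-≤ i j with R? (s , s + 2 * i + 1)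
      ... | no  _ = z≤n
      ... | yes r rewrite δ-≡ (sym (monochrome s i r)) =
        ≤-reflexive (trans (length-cartesianProductWith _ (forests f (suc s) i) (forests f (s + 2 * i + 2) j))
                           (sym (*-identityˡ _)))

  Saturated : ℕ → ℕ → Set
  Saturated s L = ∀ p d → s ≤ p → p + 2 * d + 1 < s + L → R (p , p + 2 * d + 1)

  Saturated-mono : ∀ {s L s′ L′} → Saturated s L → s ≤ s′ → s′ + L′ ≤ s + L → Saturated s′ L′
  Saturated-mono sat s≤s′ within p d s′≤p p< = sat p d (≤-trans s≤s′ s′≤p) (<-≤-trans p< within)

  Saturated-rooted : ∀ s i j → Saturated s (suc (i + j) + suc (i + j)) →
    R (s , s + 2 * i + 1) × Saturated (suc s) (i + i) × Saturated (s + 2 * i + 2) (j + j)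
  Saturated-rooted s i j sat =
    sat s i ≤-refl (≤-trans (≤-reflexive (root-end s i)) rest-≤) ,
    Saturated-mono sat (n≤1+n s) subtree-≤ ,
    Saturated-mono sat (≤-trans (m≤m+n s (2 * i)) (m≤m+n _ 2)) (≤-reflexive (sym (layout s i j)))
    where
    layout : ∀ s i j → s + (suc (i + j) + suc (i + j)) ≡ (s + 2 * i + 2) + (j + j)
    layout = solve-∀
    root-end : ∀ s i → suc (s + 2 * i + 1) ≡ s + 2 * i + 2
    root-end = solve-∀
    subtree-end : ∀ s i → suc (suc s + (i + i)) ≡ s + 2 * i + 2
    subtree-end = solve-∀
    rest-≤ : s + 2 * i + 2 ≤ s + (suc (i + j) + suc (i + j))
    rest-≤ = subst (s + 2 * i + 2 ≤_) (sym (layout s i j)) (m≤m+n _ _)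
    subtree-≤ : suc s + (i + i) ≤ s + (suc (i + j) + suc (i + j))
    subtree-≤ = ≤-trans (n≤1+n _) (≤-trans (≤-reflexive (subtree-end s i)) rest-≤)

  forests-saturated : ∀ f s e → e ≤ f → Saturated s (e + e) → length (forests f s e) ≡ cat e
  forests-saturated f       s zero    _         _   = refl
  forests-saturated (suc f) s (suc e) (s≤s e≤f) sat = begin
    length (forests (suc f) s (suc e))                 ≡⟨ length-concat-antidiagonal (rooted f s) e ⟩
    ∑-antidiagonal (λ i j → length (rooted f s i j)) e ≡⟨ ∑-antidiagonal-cong e rooted-≡ ⟩
    (cat ⋆ cat) e                                      ≡⟨ sym (cat-segner e) ⟩
    cat (suc e)                                        ∎
    where
    open ≡-Reasoning
    rooted-≡ : ∀ i j → i + j ≡ e → length (rooted f s i j) ≡ cat i * cat j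
    rooted-≡ i j refl with Saturated-rooted s i j sat
    ... | root , left , right =
      trans (length-rooted f s i j root)
            (cong₂ _*_ (forests-saturated f (suc s) i (≤-trans (m≤m+n i j) e≤f) left)
                       (forests-saturated f (s + 2 * i + 2) j (≤-trans (m≤n+m j i) e≤f) right))

Unique⇒lookup-injective : ∀ {A : Set} {xs : List A} → Unique xs → ∀ {i j} → List.lookup xs i ≡ List.lookup xs j → i ≡ j
Unique⇒lookup-injective (_    ∷ _) {Fin.zero}  {Fin.zero}  _  = refl
Unique⇒lookup-injective (x∉xs ∷ _) {Fin.zero}  {Fin.suc j} eq = ⊥-elim (All.lookup x∉xs (∈-lookup j) eq)
Unique⇒lookup-injective (x∉xs ∷ _) {Fin.suc i} {Fin.zero}  eq = ⊥-elim (All.lookup x∉xs (∈-lookup i) (sym eq))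
Unique⇒lookup-injective (_    ∷ u) {Fin.suc i} {Fin.suc j} eq = cong Fin.suc (Unique⇒lookup-injective u eq)

size-by-enumeration : ∀ {X A : Set} {k} (xs : List A) → Unique xs → (f : X → A) →
  (∀ {x y} → f x ≡ f y → x ≡ y) → (∀ x → f x ∈ xs) → (∀ {a} → a ∈ xs → Σ X λ x → f x ≡ a) →
  HasSize X k → k ≡ length xs
size-by-enumeration {A = A} xs unique f f-injective complete sound X↔Fin =
  ≤-antisym (injective⇒≤ {f = index ∘ complete ∘ to} position-injective)
            (injective⇒≤ {f = from ∘ proj₁ ∘ sound ∘ ∈-lookup} preimage-injective)
  where
  open Inverse X↔Fin
  to-injective : ∀ {i j} → to i ≡ to j → i ≡ j
  to-injective {i} {j} eq = trans (sym (strictlyInverseʳ i)) (trans (cong from eq) (strictlyInverseʳ j))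
  from-injective : ∀ {x y} → from x ≡ from y → x ≡ y
  from-injective {x} {y} eq = trans (sym (strictlyInverseˡ x)) (trans (cong to eq) (strictlyInverseˡ y))
  position-injective : ∀ {i j} → index (complete (to i)) ≡ index (complete (to j)) → i ≡ j
  position-injective eq = to-injective (f-injective (index-injective (setoid A) (complete _) (complete _) eq))
  preimage-injective : ∀ {i j} → from (proj₁ (sound (∈-lookup {xs = xs} i))) ≡ from (proj₁ (sound (∈-lookup j))) → i ≡ j
  preimage-injective {i} {j} eq = Unique⇒lookup-injective unique (begin
    List.lookup xs i                  ≡⟨ sym (proj₂ (sound (∈-lookup i))) ⟩
    f (proj₁ (sound (∈-lookup i)))    ≡⟨ cong f (from-injective eq) ⟩
    f (proj₁ (sound (∈-lookup j)))    ≡⟨ proj₂ (sound (∈-lookup j)) ⟩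
    List.lookup xs j                  ∎)
    where open ≡-Reasoning

module Word {m n′ : ℕ} (c : Complementation m) (P : Vec (Fin (2 * m)) (2 * suc n′)) where

  n : ℕ
  n = suc n′

  Letter : Set
  Letter = Fin (2 * m)

  Edge : ℕ × ℕ → Set
  Edge = LettersComplementary {m} {n} c P

  edge? : ∀ e → Dec (Edge e)
  edge? (i , j) = any? λ fi → any? λ fj →
    (suc (toℕ fi) ≟ i) ×-dec (suc (toℕ fj) ≟ j) ×-dec (comp c (lookup P fi) Fin.≟ lookup P fj)

  Edge-irrelevant : ∀ {e} → Irrelevant (Edge e)
  Edge-irrelevant (fi , fj , i≡ , j≡ , fj≡) (fi′ , fj′ , i≡′ , j≡′ , fj≡′)
    with toℕ-injective (suc-injective (trans i≡ (sym i≡′)))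
       | toℕ-injective (suc-injective (trans j≡ (sym j≡′)))
  ... | refl | refl =
    cong₂ (λ p q → fi , fj , p , q) (≡-irrelevant i≡ i≡′)
          (cong₂ _,_ (≡-irrelevant j≡ j≡′) (Decidable⇒UIP.≡-irrelevant Fin._≟_ fj≡ fj≡′))

  open Forests edge?

  comp-injective : ∀ {x y} → comp c x ≡ comp c y → x ≡ y
  comp-injective {x} {y} eq = trans (sym (involutive c x)) (trans (cong (comp c) eq) (involutive c y))

  twist : ℕ → Letter → Letter
  twist zero    x = x
  twist (suc p) x = comp c (twist p x)

  twist-+ : ∀ p q x → twist (p + q) x ≡ twist p (twist q x)
  twist-+ zero    q x = refl
  twist-+ (suc p) q x = cong (comp c) (twist-+ p q x)

  twist-even : ∀ d x → twist (d + d) x ≡ x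
  twist-even zero    x = refl
  twist-even (suc d) x rewrite +-suc d d = trans (involutive c _) (twist-even d x)

  twist-injective : ∀ p {x y} → twist p x ≡ twist p y → x ≡ y
  twist-injective zero    eq = eq
  twist-injective (suc p) eq = twist-injective p (comp-injective eq)

  twist-odd-gap : ∀ s d x → twist (s + 2 * d + 1) (comp c x) ≡ twist s x
  twist-odd-gap s d x = begin
    twist (s + 2 * d + 1) (comp c x)            ≡⟨ cong (λ p → twist p (comp c x)) (gap s d) ⟩
    twist (s + suc (d + d)) (comp c x)          ≡⟨ twist-+ s (suc (d + d)) (comp c x) ⟩
    twist s (comp c (twist (d + d) (comp c x))) ≡⟨ cong (twist s ∘ comp c) (twist-even d (comp c x)) ⟩
    twist s (comp c (comp c x))                 ≡⟨ cong (twist s) (involutive c x) ⟩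
    twist s x                                   ∎
    where
    open ≡-Reasoning
    gap : ∀ s d → s + 2 * d + 1 ≡ s + suc (d + d)
    gap = solve-∀

  twist-≡⇒complement : ∀ s d {x y} → twist s x ≡ twist (s + 2 * d + 1) y → comp c x ≡ y
  twist-≡⇒complement s d {x} {y} eq = begin
    comp c x                  ≡⟨ cong (comp c) (twist-injective s (trans eq y-twist)) ⟩
    comp c (comp c y)         ≡⟨ involutive c y ⟩
    y                         ∎
    where
    open ≡-Reasoning
    y-twist : twist (s + 2 * d + 1) y ≡ twist s (comp c y)
    y-twist = trans (cong (twist (s + 2 * d + 1)) (sym (involutive c y))) (twist-odd-gap s d (comp c y))

  letterAt : ℕ → Maybe Letter
  letterAt zero    = nothing
  letterAt (suc i) with i <? 2 * n
  ... | yes i<2n = just (lookup P (fromℕ< i<2n))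
  ... | no  _    = nothing

  letterAt-fromℕ< : ∀ {i} (i<2n : i < 2 * n) → letterAt (suc i) ≡ just (lookup P (fromℕ< i<2n))
  letterAt-fromℕ< {i} i<2n with i <? 2 * n
  ... | yes _   = refl
  ... | no  i≮ = ⊥-elim (i≮ i<2n)

  letterAt-toℕ : ∀ fi → letterAt (suc (toℕ fi)) ≡ just (lookup P fi)
  letterAt-toℕ fi = trans (letterAt-fromℕ< (toℕ<n fi)) (cong (just ∘ lookup P) (fromℕ<-toℕ fi _))

  twisted : ℕ → Maybe Letter
  twisted p = Maybe.map (twist p) (letterAt p)

  colour : ℕ → Bool
  colour p = does (≡-dec Fin._≟_ (twisted p) (twisted 1))

  open Colouring colour

  edge⇒twisted-≡ : ∀ s d → Edge (s , s + 2 * d + 1) → twisted s ≡ twisted (s + 2 * d + 1)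
  edge⇒twisted-≡ s d (fi , fj , refl , j≡ , complement) = begin
    twisted s                     ≡⟨ cong (Maybe.map (twist s)) (letterAt-toℕ fi) ⟩
    just (twist s x)              ≡⟨ cong just (sym (twist-odd-gap s d x)) ⟩
    just (twist j (comp c x))     ≡⟨ cong (just ∘ twist j) complement ⟩
    just (twist j (lookup P fj))  ≡⟨ cong (Maybe.map (twist j)) (trans (sym (letterAt-toℕ fj)) (cong letterAt j≡)) ⟩
    twisted j                     ∎
    where
    open ≡-Reasoning
    x = lookup P fi
    j = s + 2 * d + 1

  edge-monochrome : ∀ s d → Edge (s , s + 2 * d + 1) → colour s ≡ colour (s + 2 * d + 1)
  edge-monochrome s d e = cong (λ t → does (≡-dec Fin._≟_ t (twisted 1))) (edge⇒twisted-≡ s d e)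

  colour-1 : colour 1 ≡ true
  colour-1 = dec-true (≡-dec Fin._≟_ (twisted 1) (twisted 1)) refl

  colour≡true : ∀ p → colour p ≡ true → twisted p ≡ twisted 1
  colour≡true p eq with ≡-dec Fin._≟_ (twisted p) (twisted 1)
  ... | yes t≡ = t≡

  monochromatic⇒saturated : (∀ p → 1 ≤ p → p < 1 + (n + n) → colour p ≡ true) → Saturated 1 (n + n)
  monochromatic⇒saturated mono (suc i) d _ q<
    = fromℕ< i< , fromℕ< k< , cong suc (toℕ-fromℕ< i<) , cong suc (toℕ-fromℕ< k<) ,
      twist-≡⇒complement (suc i) d (just-injective (begin
        just (twist (suc i) (lookup P (fromℕ< i<)))  ≡⟨ cong (Maybe.map (twist (suc i))) (letterAt-fromℕ< i<) ⟨
        twisted (suc i)                             ≡⟨ colour≡true (suc i) (mono (suc i) (s≤s z≤n) (≤-<-trans (s≤s i≤k) q<)) ⟩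
        twisted 1                                   ≡⟨ colour≡true (suc k) (mono (suc k) (s≤s z≤n) q<) ⟨
        twisted (suc k)                             ≡⟨ cong (Maybe.map (twist (suc k))) (letterAt-fromℕ< k<) ⟩
        just (twist (suc k) (lookup P (fromℕ< k<)))  ∎))
    where
    open ≡-Reasoning
    k = i + 2 * d + 1
    i≤k : i ≤ k
    i≤k = ≤-trans (m≤m+n i (2 * d)) (m≤m+n _ 1)
    k< : k < 2 * n
    k< = subst (k <_) (cong (n +_) (sym (+-identityʳ n))) (s≤s⁻¹ q<)
    i< : i < 2 * n
    i< = ≤-<-trans i≤k k<

  children : PlaneTree → List PlaneTree
  children (node ts) = ts

  size≡length-forests : ∀ {k} → HasSize (V n c P) k → k ≡ length (forests n 1 n)
  size≡length-forests = size-by-enumeration (forests n 1 n) (forests-unique n 1 n)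
                          (children ∘ proj₁) children-injective enumerated onto
    where
    children-injective : ∀ {v w : V n c P} → children (proj₁ v) ≡ children (proj₁ w) → v ≡ w
    children-injective {node ts , e , valid} {node .ts , e′ , valid′} refl =
      cong₂ (λ p q → node ts , p , q) (≡-irrelevant e e′) (All.irrelevant Edge-irrelevant valid valid′)
    enumerated : ∀ (v : V n c P) → children (proj₁ v) ∈ forests n 1 n
    enumerated (node ts , e , valid) = subst (λ e → ts ∈ forests n 1 e) e (forests-complete n 1 ts (≤-reflexive e) valid)
    onto : ∀ {ts} → ts ∈ forests n 1 n → Σ (V n c P) λ v → children (proj₁ v) ≡ ts
    onto ts∈ = (node _ , forests-sound n 1 n ts∈) , refl

  forests-dichotomy : length (forests n 1 n) ≡ cat n ⊎ length (forests n 1 n) ≤ cat n′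
  forests-dichotomy = by-count (count false 1 (n + n)) refl
    where
    by-count : ∀ F → count false 1 (n + n) ≡ F → length (forests n 1 n) ≡ cat n ⊎ length (forests n 1 n) ≤ cat n′
    by-count zero    F≡ = inj₁ (forests-saturated n 1 n ≤-refl (monochromatic⇒saturated (count≡0 false 1 (n + n) F≡)))
    by-count (suc f) F≡ = inj₂ (≤-trans {j = colouredMatchings 1 (n + n)}
                                        (forests-≤-colouredMatchings colour edge-monochrome n 1 n)
                                        (colouredMatchings-≤-cat 1 n′ f colour-1 F≡))

  size-dichotomy : ∀ {k} → HasSize (V n c P) k → k ≡ cat n ⊎ k ≤ cat n′
  size-dichotomy {k} V↔Fin =
    Sum.map (trans k≡) (≤-trans {j = length (forests n 1 n)} (≤-reflexive k≡)) forests-dichotomy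
    where
    k≡ : k ≡ length (forests n 1 n)
    k≡ = size≡length-forests V↔Fin

mainTheorem10 : (n m : ℕ) → 1 ≤ n → 1 ≤ m → (k : ℕ) →
    catalan (n ∸ 1) < k → k < catalan n → ¬ InR n m k
mainTheorem10 (suc n′) m _ _ k lo hi (c , P , V↔Fin , _) =
  [ (λ k≡Cn → <-irrefl {k} {catalan (suc n′)} (trans k≡Cn (sym (catalan≡cat (suc n′)))) hi)
  , (λ k≤Cn′ → <⇒≱ {catalan n′} {k} lo (subst (k ≤_) (sym (catalan≡cat n′)) k≤Cn′))
  ]′ (Word.size-dichotomy c P V↔Fin)
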